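{- Let $D$ be a diagram, $z$ a cell of $D$ in row $s$, and $r<s$. Let $U$ be the diagram consisting of all cells of $D$ in rows $r,r+1,\dots,s-1$ together with the cells of $D$ in row $s$ weakly to the right of $z$ (including $z$). Let $K$ be the number of cells of $D$ in row $s$ weakly right of $z$. If $U$ is northwest and $D$ has a cell in row $r$ in the same column as $z$, then there is no $T\in\mathrm{KD}(D)$ with $\mathbf{wt}(T)=\mathbf{wt}(D)+K\alpha_{r,s}$.
   Context: A diagram is a finite set of cells $(i,j)\in\mathbb{Z}_{>0}^2$ ($i$ row, $j$ column), rows numbered top to bottom (row 1 on top). A diagram is northwest if whenever $(j,k),(i,l)$ are cells with $i<j$, $k<l$, then $(i,k)$ is a cell. A Kohnert move selects the rightmost cell of some row and moves it up (toward row 1) within its column to the first empty position above it, jumping over occupied positions, if one exists; $\mathrm{KD}(D)$ is the set of diagrams reachable from $D$ by sequences of Kohnert moves (including $D$). $\mathbf{wt}(T)$ is the weak composition whose $i$th part is the number of cells of $T$ in row $i$. For $r<s$, $\alpha_{r,s}$ is the integer vector with $1$ in position $r$, $-1$ in position $s$, and $0$ elsewhere. -}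

module Defs where

open import Data.Nat using (ℕ; _≤_; _<_; _≟_; _≤?_)
open import Data.Integer as ℤ using (ℤ; +_; -_)
open import Data.Product using (Σ; _×_; _,_; proj₁; proj₂; ∃-syntax)
open import Data.Sum using (_⊎_)
open import Data.List using (List; length; filter)
open import Data.List.Membership.Propositional using (_∈_)
open import Data.List.Relation.Unary.All using (All)
open import Data.List.Relation.Unary.Unique.Propositional using (Unique)
open import Relation.Binary.PropositionalEquality using (_≡_; _≢_)
open import Relation.Nullary using (¬_; yes; no)
open import Relation.Binary.Construct.Closure.ReflexiveTransitive using (Star)

-- A cell (i , j): i = row (numbered top to bottom, row 1 on top), j = column.
Cell : Set
Cell = ℕ × ℕ

row : Cell → ℕ
row = proj₁

col : Cell → ℕ
col = proj₂

record Diagram : Set where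
  field
    cells    : List Cell
    unique   : Unique cells
    positive : All (λ x → 1 ≤ row x × 1 ≤ col x) cells
open Diagram public

_∈D_ : Cell → Diagram → Set
x ∈D D = x ∈ cells D

Northwest : (Cell → Set) → Set
Northwest P = ∀ i j k l → P (j , k) → P (i , l) → i < j → k < l → P (i , k)

KohnertMove : Diagram → Diagram → Set
KohnertMove D D' =
  Σ ℕ λ i → Σ ℕ λ c → Σ ℕ λ k →
    ((i , c) ∈D D)
  × (∀ c' → (i , c') ∈D D → c' ≤ c)
  × (1 ≤ k) × (k < i)
  × (¬ ((k , c) ∈D D))
  × (∀ m → k < m → m < i → (m , c) ∈D D)
  × (∀ x → (x ∈D D' → ((x ∈D D × x ≢ (i , c)) ⊎ x ≡ (k , c)))
         × (((x ∈D D × x ≢ (i , c)) ⊎ x ≡ (k , c)) → x ∈D D'))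

_∈KD_ : Diagram → Diagram → Set
T ∈KD D = Star KohnertMove D T

wt : Diagram → ℕ → ℕ
wt D i = length (filter (λ x → row x ≟ i) (cells D))

α : ℕ → ℕ → ℕ → ℤ
α r s i with i ≟ r
... | yes _ = + 1
... | no _ with i ≟ s
...   | yes _ = - (+ 1)
...   | no _ = + 0

InU : Diagram → Cell → ℕ → Cell → Set
InU D z r x = (x ∈D D) × ((r ≤ row x × row x < row z) ⊎ (row x ≡ row z × col z ≤ col x))

Kcount : Diagram → Cell → ℕ
Kcount D z = length (filter (λ x → row x ≟ row z) (filter (λ x → col z ≤? col x) (cells D)))

module Submission where

-- Kohnert moves only move cells up inside their columns, so for every set of columns the number
-- of cells above a fixed row never decreases along KD(D). The weight condition fixes these counts
-- (over all columns): T has as many cells as D above row m for m ≤ r and for m = s + 1, and K more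
-- for r < m ≤ s. An invariant along the moves shows that the part of row s left of z cannot shrink
-- before the rows above s already hold more than K extra cells, so in T row s lies strictly left
-- of z, and column c gains a cell (p , c) with r ≤ p < s that is not in D. Since U is northwest,
-- a row q ∈ [r , s) of D avoiding column c lies left of c, and no row of T in [r , s) has more
-- cells left of c than in D. In row p, T even has fewer, so T has fewer cells left of c above row
-- p + 1 than D, contradicting monotonicity.

open import Defs
open import Data.Nat using (ℕ; _<_)

module Counting where

  open import Data.Nat using (suc; _+_; _≤_; z≤n; s≤s)
  open import Data.Nat.Properties
  open import Data.List using (List; []; _∷_; length; filter)
  open import Data.List.Properties using (filter-≐; filter-none)
  open import Data.List.Membership.Propositional using (_∈_; _∉_)
  open import Data.List.Membership.Propositional.Properties using (∈-filter⁺; ∈-filter⁻; ∈-length)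
  open import Data.List.Relation.Binary.Subset.Propositional using (_⊆_)
  open import Data.List.Relation.Unary.Any using (here; there)
  open import Data.List.Relation.Unary.All as All using (All)
  open import Data.List.Relation.Unary.AllPairs using (_∷_)
  open import Data.List.Relation.Unary.Unique.Propositional using (Unique)
  import Data.List.Relation.Unary.Unique.Propositional.Properties as Unique
  open import Data.Product using (∃; _×_; _,_)
  open import Function using (_⇔_; Equivalence)
  open import Level using (Level)
  open import Relation.Binary.Definitions using (DecidableEquality)
  open import Relation.Binary.PropositionalEquality
  open import Relation.Nullary using (¬_; yes; no; contradiction)
  open import Relation.Unary using (Pred; Decidable; _≐_)
  open import Relation.Unary.Properties using (_∩?_; ∁?)

  private variable
    a p q : Level
    A : Set a

  count : {P : Pred A p} → Decidable P → List A → ℕ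
  count P? xs = length (filter P? xs)

  module _ {P : Pred A p} (P? : Decidable P) where

    count-split : {Q : Pred A q} (Q? : Decidable Q) (xs : List A) →
      count P? xs ≡ count (P? ∩? Q?) xs + count (P? ∩? ∁? Q?) xs
    count-split Q? [] = refl
    count-split Q? (x ∷ xs) with P? x | Q? x
    ... | yes _ | yes _ = cong suc (count-split Q? xs)
    ... | yes _ | no _  = trans (cong suc (count-split Q? xs)) (sym (+-suc _ _))
    ... | no _  | _     = count-split Q? xs

    count-filter : {Q : Pred A q} (Q? : Decidable Q) (xs : List A) →
      count P? (filter Q? xs) ≡ count (Q? ∩? P?) xs
    count-filter Q? [] = refl
    count-filter Q? (x ∷ xs) with Q? x
    ... | no _ = count-filter Q? xs
    ... | yes _ with P? x
    ...   | yes _ = cong suc (count-filter Q? xs)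
    ...   | no _ = count-filter Q? xs

    ∈⇒count-pos : {x : A} {xs : List A} → x ∈ xs → P x → 0 < count P? xs
    ∈⇒count-pos x∈xs px = ∈-length (∈-filter⁺ P? x∈xs px)

    count-pos⇒∈ : (xs : List A) → 0 < count P? xs → ∃ λ x → x ∈ xs × P x
    count-pos⇒∈ xs _ with filter P? xs in eq
    ... | y ∷ _ = y , ∈-filter⁻ P? (subst (y ∈_) (sym eq) (here refl))

    count-∷-mono : {x y : A} {xs ys : List A} → (P x → P y) →
      count P? (x ∷ ys) ≡ count P? (y ∷ xs) → count P? xs ≤ count P? ys
    count-∷-mono {x} {y} Px⇒Py eq with P? x | P? y
    ... | yes _  | yes _  = ≤-reflexive (suc-injective (sym eq))
    ... | yes px | no ¬py = contradiction (Px⇒Py px) ¬py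
    ... | no _   | yes _  = ≤-trans (n≤1+n _) (≤-reflexive (sym eq))
    ... | no _   | no _   = ≤-reflexive (sym eq)

    count-∷-shift : {x y : A} {xs ys : List A} → ¬ P x → P y →
      count P? (x ∷ ys) ≡ count P? (y ∷ xs) → count P? ys ≡ suc (count P? xs)
    count-∷-shift {x} {y} ¬px py eq with P? x | P? y
    ... | yes px | _      = contradiction px ¬px
    ... | no _   | no ¬py = contradiction py ¬py
    ... | no _   | yes _  = eq

    count≡0 : {xs : List A} → (∀ {x} → x ∈ xs → ¬ P x) → count P? xs ≡ 0
    count≡0 {xs} ¬p = cong length (filter-none P? (All.tabulate ¬p))

  count-≐ : {P : Pred A p} {Q : Pred A q} (P? : Decidable P) (Q? : Decidable Q) →
    P ≐ Q → (xs : List A) → count P? xs ≡ count Q? xs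
  count-≐ P? Q? P≐Q xs = cong length (filter-≐ P? Q? P≐Q xs)

  module _ (_≟_ : DecidableEquality A) where

    private
      remove : A → List A → List A
      remove x [] = []
      remove x (y ∷ ys) with x ≟ y
      ... | yes _ = ys
      ... | no _  = y ∷ remove x ys

      length-remove : {x : A} (ys : List A) → x ∈ ys → length ys ≡ suc (length (remove x ys))
      length-remove {x} (y ∷ ys) x∈ with x ≟ y | x∈
      ... | yes _  | _          = refl
      ... | no x≢y | here x≡y   = contradiction x≡y x≢y
      ... | no _   | there x∈ys = cong suc (length-remove ys x∈ys)

      ∈-remove⁺ : {x y : A} (ys : List A) → y ∈ ys → y ≢ x → y ∈ remove x ys
      ∈-remove⁺ {x} (z ∷ ys) y∈ y≢x with x ≟ z | y∈
      ... | yes refl | here y≡x = contradiction y≡x y≢x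
      ... | yes refl | there y∈ys = y∈ys
      ... | no _     | here y≡z = here y≡z
      ... | no _     | there y∈ys = there (∈-remove⁺ ys y∈ys y≢x)

    length-mono-⊆ : {xs ys : List A} → Unique xs → xs ⊆ ys → length xs ≤ length ys
    length-mono-⊆ {[]} _ _ = z≤n
    length-mono-⊆ {x ∷ xs} {ys} (x∉xs ∷ uxs) xs⊆ys = begin
      suc (length xs)             ≤⟨ s≤s (length-mono-⊆ uxs xs⊆ys-x) ⟩
      suc (length (remove x ys))  ≡⟨ length-remove ys (xs⊆ys (here refl)) ⟨
      length ys                   ∎
      where
      open ≤-Reasoning
      xs⊆ys-x : xs ⊆ remove x ys
      xs⊆ys-x y∈xs = ∈-remove⁺ ys (xs⊆ys (there y∈xs)) (λ y≡x → All.lookup x∉xs y∈xs (sym y≡x))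

    count-mono-⊆ : {P : Pred A p} (P? : Decidable P) {xs ys : List A} → Unique xs →
      (∀ {x} → x ∈ xs → P x → x ∈ ys) → count P? xs ≤ count P? ys
    count-mono-⊆ P? uxs incl = length-mono-⊆ (Unique.filter⁺ P? uxs) λ x∈ →
      let (x∈xs , px) = ∈-filter⁻ P? x∈ in ∈-filter⁺ P? (incl x∈xs px) px

    count-≡-set : {P : Pred A p} (P? : Decidable P) {xs ys : List A} → Unique xs → Unique ys →
      (∀ {x} → x ∈ xs ⇔ x ∈ ys) → count P? xs ≡ count P? ys
    count-≡-set P? uxs uys xs≈ys = ≤-antisym
      (count-mono-⊆ P? uxs λ x∈ _ → Equivalence.to xs≈ys x∈)
      (count-mono-⊆ P? uys λ x∈ _ → Equivalence.from xs≈ys x∈)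

    count-<⇒∃∉ : {P : Pred A p} (P? : Decidable P) {xs ys : List A} → Unique xs →
      count P? ys < count P? xs → ∃ λ x → x ∈ xs × P x × x ∉ ys
    count-<⇒∃∉ P? {xs} {ys} uxs ys<xs = count-pos⇒∈ (P? ∩? ∁? (_∈? ys)) xs fresh-pos
      where
      open import Data.List.Membership.DecPropositional _≟_ using (_∈?_)
      shared fresh : List A → ℕ
      shared = count (P? ∩? (_∈? ys))
      fresh = count (P? ∩? ∁? (_∈? ys))
      shared-xs≤ys : shared xs ≤ count P? ys
      shared-xs≤ys = begin
        shared xs             ≤⟨ count-mono-⊆ (P? ∩? (_∈? ys)) uxs (λ _ (_ , x∈ys) → x∈ys) ⟩
        shared ys             ≤⟨ m≤m+n _ _ ⟩
        shared ys + fresh ys  ≡⟨ count-split P? (_∈? ys) ys ⟨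
        count P? ys           ∎
        where open ≤-Reasoning
      fresh-pos : 0 < fresh xs
      fresh-pos = +-cancelˡ-< (shared xs) 0 _ (begin-strict
        shared xs + 0         ≡⟨ +-identityʳ _ ⟩
        shared xs             ≤⟨ shared-xs≤ys ⟩
        count P? ys           <⟨ ys<xs ⟩
        count P? xs           ≡⟨ count-split P? (_∈? ys) xs ⟩
        shared xs + fresh xs  ∎)
        where open ≤-Reasoning

module CellCounts where

  open Counting
  open import Data.Nat using (suc; _+_; _≤_)
  open import Data.Nat.Properties
  open import Data.List using (_∷_)
  open import Data.List.Membership.Propositional using (_∈_)
  open import Data.List.Relation.Unary.Any using (here; there)
  import Data.List.Relation.Unary.All as All
  open import Data.List.Relation.Unary.AllPairs using (_∷_)
  open import Data.Product using (_×_; _,_; proj₁; proj₂)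
  open import Data.Product.Properties using (≡-dec)
  open import Data.Sum using (inj₁; inj₂)
  open import Data.Unit using (tt)
  open import Function using (_∘_; mk⇔; case_of_)
  open import Level using (0ℓ)
  open import Relation.Binary.Construct.Closure.ReflexiveTransitive using (fold)
  open import Relation.Binary.Definitions using (DecidableEquality)
  open import Relation.Binary.PropositionalEquality
  open import Relation.Nullary using (yes; no; _×-dec_)
  open import Relation.Unary using (Pred; Decidable; _≐_; _⊆_; _∩_; ∁; U)
  open import Relation.Unary.Properties using (_∩?_; ∁?; U?; ≐-refl)

  _≟ᶜ_ : DecidableEquality Cell
  _≟ᶜ_ = ≡-dec _≟_ _≟_

  #cells : {P : Pred Cell 0ℓ} → Decidable P → Diagram → ℕ
  #cells P? X = count P? (cells X)

  Rect : Pred ℕ 0ℓ → Pred ℕ 0ℓ → Pred Cell 0ℓ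
  Rect R C x = R (row x) × C (col x)

  private variable
    R R′ C C′ S : Pred ℕ 0ℓ
    P : Pred Cell 0ℓ
    X Y : Diagram

  rect? : Decidable R → Decidable C → Decidable (Rect R C)
  rect? R? C? x = R? (row x) ×-dec C? (col x)

  #rect : Decidable R → Decidable C → Diagram → ℕ
  #rect R? C? = #cells (rect? R? C?)

  #rect-≐ : (R? : Decidable R) (R′? : Decidable R′) (C? : Decidable C) (C′? : Decidable C′) →
    R ≐ R′ → C ≐ C′ → (X : Diagram) → #rect R? C? X ≡ #rect R′? C′? X
  #rect-≐ R? R′? C? C′? (R⊆ , ⊇R) (C⊆ , ⊇C) X =
    count-≐ (rect? R? C?) (rect? R′? C′?)
      ((λ (r , c) → R⊆ r , C⊆ c) , (λ (r , c) → ⊇R r , ⊇C c)) (cells X)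

  #rect-split-rows : (R? : Decidable R) (C? : Decidable C) (S? : Decidable S) (X : Diagram) →
    #rect R? C? X ≡ #rect (R? ∩? S?) C? X + #rect (R? ∩? ∁? S?) C? X
  #rect-split-rows R? C? S? X = trans (count-split (rect? R? C?) (S? ∘ row) (cells X))
    (cong₂ _+_ (count-≐ _ _ regroup (cells X)) (count-≐ _ _ regroup (cells X)))
    where
    regroup : ∀ {T : Pred ℕ 0ℓ} → Rect R C ∩ (T ∘ row) ≐ Rect (R ∩ T) C
    regroup = (λ ((r , c) , t) → (r , t) , c) , (λ ((r , t) , c) → (r , c) , t)

  #rect-split-cols : (R? : Decidable R) (C? : Decidable C) (S? : Decidable S) (X : Diagram) →
    #rect R? C? X ≡ #rect R? (C? ∩? S?) X + #rect R? (C? ∩? ∁? S?) X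
  #rect-split-cols R? C? S? X = trans (count-split (rect? R? C?) (S? ∘ col) (cells X))
    (cong₂ _+_ (count-≐ _ _ regroup (cells X)) (count-≐ _ _ regroup (cells X)))
    where
    regroup : ∀ {T : Pred ℕ 0ℓ} → Rect R C ∩ (T ∘ col) ≐ Rect R (C ∩ T)
    regroup = (λ ((r , c) , t) → r , (c , t)) , (λ (r , (c , t)) → (r , c) , t)

  -- Rows are numbered from the top, so the rows above row m are those with index < m.
  #above : ℕ → Decidable C → Diagram → ℕ
  #above m C? = #rect (_<? m) C?

  #row : ℕ → Decidable C → Diagram → ℕ
  #row m C? = #rect (_≟ m) C?

  between? : (lo hi : ℕ) → Decidable (λ i → lo ≤ i × i < hi)
  between? lo hi i = lo ≤? i ×-dec i <? hi

  #band : ℕ → ℕ → Decidable C → Diagram → ℕ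
  #band lo hi C? = #rect (between? lo hi) C?

  #left #right : ℕ → ℕ → Diagram → ℕ
  #left m c = #row m (_<? c)
  #right m c = #row m (c ≤?_)

  #above-zero : (C? : Decidable C) (X : Diagram) → #above 0 C? X ≡ 0
  #above-zero C? X = count≡0 (rect? (_<? 0) C?) {cells X} λ _ → λ ()

  #above-suc : (m : ℕ) (C? : Decidable C) (X : Diagram) →
    #above (suc m) C? X ≡ #above m C? X + #row m C? X
  #above-suc m C? X = trans (#rect-split-rows (_<? suc m) C? (_<? m) X)
    (cong₂ _+_ (#rect-≐ ((_<? suc m) ∩? (_<? m)) (_<? m) C? C? earlier ≐-refl X)
               (#rect-≐ ((_<? suc m) ∩? ∁? (_<? m)) (_≟ m) C? C? exactly ≐-refl X))
    where
    earlier : (_< suc m) ∩ (_< m) ≐ (_< m)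
    earlier = proj₂ , λ i<m → m<n⇒m<1+n i<m , i<m
    exactly : (_< suc m) ∩ ∁ (_< m) ≐ (_≡ m)
    exactly = (λ (i<1+m , i≮m) → ≤-antisym (≤-pred i<1+m) (≮⇒≥ i≮m))
            , λ { refl → n<1+n m , <-irrefl refl }

  #above-band : {lo hi : ℕ} → lo ≤ hi → (C? : Decidable C) (X : Diagram) →
    #above hi C? X ≡ #above lo C? X + #band lo hi C? X
  #above-band {lo = lo} {hi} lo≤hi C? X = trans (#rect-split-rows (_<? hi) C? (_<? lo) X)
    (cong₂ _+_ (#rect-≐ ((_<? hi) ∩? (_<? lo)) (_<? lo) C? C? earlier ≐-refl X)
               (#rect-≐ ((_<? hi) ∩? ∁? (_<? lo)) (between? lo hi) C? C? between ≐-refl X))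
    where
    earlier : (_< hi) ∩ (_< lo) ≐ (_< lo)
    earlier = proj₂ , λ i<lo → <-≤-trans i<lo lo≤hi , i<lo
    between : (_< hi) ∩ ∁ (_< lo) ≐ (λ i → lo ≤ i × i < hi)
    between = (λ (i<hi , i≮lo) → ≮⇒≥ i≮lo , i<hi) , λ (lo≤i , i<hi) → i<hi , ≤⇒≯ lo≤i

  #row-split : (m c : ℕ) (X : Diagram) → #row m U? X ≡ #left m c X + #right m c X
  #row-split m c X = trans (#rect-split-cols (_≟ m) U? (_<? c) X)
    (cong₂ _+_ (#rect-≐ (_≟ m) (_≟ m) (U? ∩? (_<? c)) (_<? c) ≐-refl left X)
               (#rect-≐ (_≟ m) (_≟ m) (U? ∩? ∁? (_<? c)) (c ≤?_) ≐-refl right X))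
    where
    left : U ∩ (_< c) ≐ (_< c)
    left = proj₂ , (tt ,_)
    right : U ∩ ∁ (_< c) ≐ (c ≤_)
    right = (≮⇒≥ ∘ proj₂) , λ c≤j → tt , ≤⇒≯ c≤j

  wt≡#row : (X : Diagram) (m : ℕ) → wt X m ≡ #row m U? X
  wt≡#row X m = count-≐ (λ x → row x ≟ m) (rect? (_≟ m) U?) ((_, tt) , proj₁) (cells X)

  Kcount≡#right : (X : Diagram) (s c : ℕ) → Kcount X (s , c) ≡ #right s c X
  Kcount≡#right X s c = trans (count-filter (λ x → row x ≟ s) (λ x → c ≤? col x) (cells X))
    (count-≐ _ (rect? (_≟ s) (c ≤?_))
      ((λ (c≤j , i≡s) → i≡s , c≤j) , λ (i≡s , c≤j) → c≤j , i≡s) (cells X))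

  wt-split : (X : Diagram) (m c : ℕ) → wt X m ≡ #left m c X + #right m c X
  wt-split X m c = trans (wt≡#row X m) (#row-split m c X)

  source target : {X Y : Diagram} → KohnertMove X Y → Cell
  source (i , j , _) = i , j
  target (i , j , k , _) = k , j

  #cells-exchange : (mv : KohnertMove X Y) (P? : Decidable P) →
    count P? (source {X} {Y} mv ∷ cells Y) ≡ count P? (target {X} {Y} mv ∷ cells X)
  #cells-exchange {X} {Y} (i , j , k , ij∈X , _ , _ , _ , kj∉X , _ , moved) P? =
    count-≡-set _≟ᶜ_ P? (ij∉Y ∷ unique Y) (kj∉X′ ∷ unique X) (mk⇔ to from)
    where
    ij∉Y : All.All ((i , j) ≢_) (cells Y)
    ij∉Y = All.tabulate λ {x} x∈Y ij≡x → case proj₁ (moved x) x∈Y of λ where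
      (inj₁ (_ , x≢ij)) → x≢ij (sym ij≡x)
      (inj₂ x≡kj) → kj∉X (subst (_∈ cells X) (trans ij≡x x≡kj) ij∈X)
    kj∉X′ : All.All ((k , j) ≢_) (cells X)
    kj∉X′ = All.tabulate λ x∈X kj≡x → kj∉X (subst (_∈ cells X) (sym kj≡x) x∈X)
    to : ∀ {x} → x ∈ (i , j) ∷ cells Y → x ∈ (k , j) ∷ cells X
    to (here refl) = there ij∈X
    to {x} (there x∈Y) with proj₁ (moved x) x∈Y
    ... | inj₁ (x∈X , _) = there x∈X
    ... | inj₂ x≡kj = here x≡kj
    from : ∀ {x} → x ∈ (k , j) ∷ cells X → x ∈ (i , j) ∷ cells Y
    from {x} (here x≡kj) = there (proj₂ (moved x) (inj₂ x≡kj))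
    from {x} (there x∈X) with x ≟ᶜ (i , j)
    ... | yes x≡ij = here x≡ij
    ... | no x≢ij = there (proj₂ (moved x) (inj₁ (x∈X , x≢ij)))

  UpClosed : Pred Cell 0ℓ → Set
  UpClosed P = ∀ {i k j} → k ≤ i → P (i , j) → P (k , j)

  #cells-mono-move : (P? : Decidable P) (mv : KohnertMove X Y) →
    (P (source {X} {Y} mv) → P (target {X} {Y} mv)) → #cells P? X ≤ #cells P? Y
  #cells-mono-move {X = X} {Y = Y} P? mv src⇒tgt =
    count-∷-mono P? {xs = cells X} {cells Y} src⇒tgt (#cells-exchange {X} {Y} mv P?)

  #cells-mono-KD : UpClosed P → (P? : Decidable P) → Y ∈KD X → #cells P? X ≤ #cells P? Y
  #cells-mono-KD {P = P} up P? = fold (λ X Y → #cells P? X ≤ #cells P? Y)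
    (λ {X} {Y} mv → ≤-trans (#cells-mono-move {X = X} {Y = Y} P? mv (up-step {X} {Y} mv))) ≤-refl
    where
    up-step : (mv : KohnertMove X Y) → P (source {X} {Y} mv) → P (target {X} {Y} mv)
    up-step (_ , _ , _ , _ , _ , _ , k<i , _) = up (<⇒≤ k<i)

  #above-mono : (m : ℕ) (C? : Decidable C) → Y ∈KD X → #above m C? X ≤ #above m C? Y
  #above-mono m C? = #cells-mono-KD (λ k≤i (i<m , c) → ≤-<-trans k≤i i<m , c) (rect? (_<? m) C?)

  #above-restrict-≤ : (m : ℕ) (C? : Decidable C) (C′? : Decidable C′) → C′ ⊆ C → Y ∈KD X →
    #above m C? Y ≤ #above m C? X → #above m C′? Y ≤ #above m C′? X
  #above-restrict-≤ {C′ = C′} {Y = Y} {X = X} m C? C′? C′⊆C Y∈KD Y≤X =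
    +-cancelʳ-≤ (#above m rest Y) (#above m C′? Y) (#above m C′? X) (begin
      #above m C′? Y + #above m rest Y  ≡⟨ split Y ⟨
      #above m C? Y                     ≤⟨ Y≤X ⟩
      #above m C? X                     ≡⟨ split X ⟩
      #above m C′? X + #above m rest X  ≤⟨ +-monoʳ-≤ _ (#above-mono m rest Y∈KD) ⟩
      #above m C′? X + #above m rest Y  ∎)
    where
    open ≤-Reasoning
    rest = C? ∩? ∁? C′?
    split : ∀ Z → #above m C? Z ≡ #above m C′? Z + #above m rest Z
    split Z = trans (#rect-split-cols (_<? m) C? C′? Z)
      (cong (_+ #above m rest Z)
        (#rect-≐ (_<? m) (_<? m) (C? ∩? C′?) C′? ≐-refl (proj₂ , λ c′ → C′⊆C c′ , c′) Z))

  #above-≡-of-total : (m : ℕ) (C? : Decidable C) → Y ∈KD X →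
    #above m U? Y ≡ #above m U? X → #above m C? Y ≡ #above m C? X
  #above-≡-of-total m C? Y∈KD eq =
    ≤-antisym (#above-restrict-≤ m U? C? (λ _ → tt) Y∈KD (≤-reflexive eq)) (#above-mono m C? Y∈KD)

  #above-move-out-of-row : (m : ℕ) (mv : KohnertMove X Y) → row (source {X} {Y} mv) ≡ m →
    #above m U? Y ≡ suc (#above m U? X)
  #above-move-out-of-row {X = X} {Y = Y} m mv@(_ , _ , _ , _ , _ , _ , k<i , _) refl =
    count-∷-shift (rect? (_<? m) U?) {xs = cells X} {cells Y} (λ (i<i , _) → <-irrefl refl i<i) (k<i , tt)
      (#cells-exchange {X} {Y} mv (rect? (_<? m) U?))

  #above-suc-wt : (m : ℕ) (X : Diagram) → #above (suc m) U? X ≡ #above m U? X + wt X m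
  #above-suc-wt m X = trans (#above-suc m U? X) (cong (#above m U? X +_) (sym (wt≡#row X m)))

  rightmost⇒#right≡0 : {s y c : ℕ} → (∀ c′ → (s , c′) ∈D X → c′ ≤ y) → y < c → #right s c X ≡ 0
  rightmost⇒#right≡0 {X} {s} {c = c} rightmost y<c = count≡0 (rect? (_≟ s) (c ≤?_)) {cells X}
    λ { {i , j} x∈X (refl , c≤j) → <⇒≱ (≤-<-trans (rightmost j x∈X) y<c) c≤j }

module Weights where

  open CellCounts
  open import Data.Nat using (zero; suc; _+_; _≤_)
  open import Data.Nat.Properties
  open import Data.Integer as ℤ using (+_; -_)
  import Data.Integer.Properties as ℤ
  open import Algebra.Properties.CommutativeSemigroup +-commutativeSemigroup using (xy∙z≈xz∙y)
  open import Function using (_∘_)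
  open import Relation.Binary.PropositionalEquality
  open import Relation.Nullary using (yes; no; contradiction)
  open import Relation.Unary.Properties using (U?)

  module WeightShift {D T : Diagram} {r s K : ℕ} (r<s : r < s)
                     (shift : ∀ i → + wt T i ≡ + wt D i ℤ.+ + K ℤ.* α r s i) where

    private
      α-at-r : α r s r ≡ + 1
      α-at-r with r ≟ r
      ... | yes _ = refl
      ... | no r≢r = contradiction refl r≢r

      α-at-s : α r s s ≡ - + 1
      α-at-s with s ≟ r
      ... | yes s≡r = contradiction (sym s≡r) (<⇒≢ r<s)
      ... | no _ with s ≟ s
      ...   | yes _ = refl
      ...   | no s≢s = contradiction refl s≢s

      α-elsewhere : {i : ℕ} → i ≢ r → i ≢ s → α r s i ≡ + 0
      α-elsewhere {i} i≢r i≢s with i ≟ r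
      ... | yes i≡r = contradiction i≡r i≢r
      ... | no _ with i ≟ s
      ...   | yes i≡s = contradiction i≡s i≢s
      ...   | no _ = refl

    wt-elsewhere : {i : ℕ} → i ≢ r → i ≢ s → wt T i ≡ wt D i
    wt-elsewhere {i} i≢r i≢s = ℤ.+-injective (begin
      + wt T i                      ≡⟨ shift i ⟩
      + wt D i ℤ.+ + K ℤ.* α r s i  ≡⟨ cong (λ a → + wt D i ℤ.+ + K ℤ.* a) (α-elsewhere i≢r i≢s) ⟩
      + wt D i ℤ.+ + K ℤ.* + 0      ≡⟨ cong (λ a → + wt D i ℤ.+ a) (ℤ.*-zeroʳ (+ K)) ⟩
      + wt D i ℤ.+ + 0              ≡⟨ ℤ.+-identityʳ _ ⟩
      + wt D i                      ∎)
      where open ≡-Reasoning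

    wt-at-r : wt T r ≡ wt D r + K
    wt-at-r = ℤ.+-injective (begin
      + wt T r                      ≡⟨ shift r ⟩
      + wt D r ℤ.+ + K ℤ.* α r s r  ≡⟨ cong (λ a → + wt D r ℤ.+ + K ℤ.* a) α-at-r ⟩
      + wt D r ℤ.+ + K ℤ.* + 1      ≡⟨ cong (λ a → + wt D r ℤ.+ a) (ℤ.*-identityʳ (+ K)) ⟩
      + wt D r ℤ.+ + K              ≡⟨ ℤ.pos-+ (wt D r) K ⟨
      + (wt D r + K)                ∎)
      where open ≡-Reasoning

    wt-at-s : wt T s + K ≡ wt D s
    wt-at-s = ℤ.+-injective (begin
      + (wt T s + K)                          ≡⟨ ℤ.pos-+ (wt T s) K ⟩
      + wt T s ℤ.+ + K                        ≡⟨ cong (ℤ._+ + K) (shift s) ⟩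
      (+ wt D s ℤ.+ + K ℤ.* α r s s) ℤ.+ + K  ≡⟨ cong (λ a → (+ wt D s ℤ.+ + K ℤ.* a) ℤ.+ + K) α-at-s ⟩
      (+ wt D s ℤ.+ + K ℤ.* - + 1) ℤ.+ + K    ≡⟨ cong (λ a → (+ wt D s ℤ.+ a) ℤ.+ + K) K*-1≡-K ⟩
      (+ wt D s ℤ.+ - + K) ℤ.+ + K            ≡⟨ ℤ.+-assoc (+ wt D s) (- + K) (+ K) ⟩
      + wt D s ℤ.+ (- + K ℤ.+ + K)            ≡⟨ cong (λ a → + wt D s ℤ.+ a) (ℤ.+-inverseˡ (+ K)) ⟩
      + wt D s ℤ.+ + 0                        ≡⟨ ℤ.+-identityʳ _ ⟩
      + wt D s                                ∎)
      where
      open ≡-Reasoning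
      K*-1≡-K : + K ℤ.* - + 1 ≡ - + K
      K*-1≡-K = trans (ℤ.*-comm (+ K) (- + 1)) (ℤ.-1*i≡-i (+ K))

    #above-upto-r : {m : ℕ} → m ≤ r → #above m U? T ≡ #above m U? D
    #above-upto-r {zero} _ = trans (#above-zero U? T) (sym (#above-zero U? D))
    #above-upto-r {suc m} m<r = begin
      #above (suc m) U? T     ≡⟨ #above-suc-wt m T ⟩
      #above m U? T + wt T m  ≡⟨ cong₂ _+_ (#above-upto-r (<⇒≤ m<r)) (wt-elsewhere (<⇒≢ m<r) (<⇒≢ (<-trans m<r r<s))) ⟩
      #above m U? D + wt D m  ≡⟨ #above-suc-wt m D ⟨
      #above (suc m) U? D     ∎
      where open ≡-Reasoning

    #above-between : {m : ℕ} → r < m → m ≤ s → #above m U? T ≡ #above m U? D + K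
    #above-between {suc m} r<1+m 1+m≤s with m ≟ r
    ... | yes refl = begin
      #above (suc r) U? T           ≡⟨ #above-suc-wt r T ⟩
      #above r U? T + wt T r        ≡⟨ cong₂ _+_ (#above-upto-r ≤-refl) wt-at-r ⟩
      #above r U? D + (wt D r + K)  ≡⟨ +-assoc (#above r U? D) (wt D r) K ⟨
      #above r U? D + wt D r + K    ≡⟨ cong (_+ K) (#above-suc-wt r D) ⟨
      #above (suc r) U? D + K       ∎
      where open ≡-Reasoning
    ... | no m≢r = begin
      #above (suc m) U? T         ≡⟨ #above-suc-wt m T ⟩
      #above m U? T + wt T m      ≡⟨ cong₂ _+_ (#above-between r<m (<⇒≤ 1+m≤s)) (wt-elsewhere m≢r (<⇒≢ 1+m≤s)) ⟩
      #above m U? D + K + wt D m  ≡⟨ xy∙z≈xz∙y (#above m U? D) K (wt D m) ⟩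
      #above m U? D + wt D m + K  ≡⟨ cong (_+ K) (#above-suc-wt m D) ⟨
      #above (suc m) U? D + K     ∎
      where
      open ≡-Reasoning
      r<m = ≤∧≢⇒< (≤-pred r<1+m) (m≢r ∘ sym)

    #above-past-s : #above (suc s) U? T ≡ #above (suc s) U? D
    #above-past-s = begin
      #above (suc s) U? T           ≡⟨ #above-suc-wt s T ⟩
      #above s U? T + wt T s        ≡⟨ cong (_+ wt T s) (#above-between r<s ≤-refl) ⟩
      #above s U? D + K + wt T s    ≡⟨ xy∙z≈xz∙y (#above s U? D) K (wt T s) ⟩
      #above s U? D + wt T s + K    ≡⟨ +-assoc (#above s U? D) (wt T s) K ⟩
      #above s U? D + (wt T s + K)  ≡⟨ cong (λ n → #above s U? D + n) wt-at-s ⟩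
      #above s U? D + wt D s        ≡⟨ #above-suc-wt s D ⟨
      #above (suc s) U? D           ∎
      where open ≡-Reasoning

module LeftOfRow (s c : ℕ) where

  open Counting
  open CellCounts
  open import Data.Nat using (suc; _+_; _≤_)
  open import Data.Nat.Properties
  open import Data.Product using (_×_; _,_)
  open import Data.Sum using (_⊎_; inj₁; inj₂)
  open import Relation.Binary.Construct.Closure.ReflexiveTransitive using (ε; _◅_; _◅◅_; foldl)
  open import Relation.Binary.PropositionalEquality
  open import Relation.Nullary using (yes; no; contradiction; _×-dec_)
  open import Relation.Unary.Properties using (U?)
  open import Algebra.Properties.CommutativeSemigroup +-commutativeSemigroup using (x∙yz≈xz∙y)

  #left-≤-of-#above-≡ : {D X : Diagram} → X ∈KD D →
    #above (suc s) U? X ≡ #above (suc s) U? D → #left s c X ≤ #left s c D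
  #left-≤-of-#above-≡ {D} {X} X∈KD top≡ = +-cancelˡ-≤ (#above s (_<? c) D) _ _ (begin
    #above s (_<? c) D + #left s c X  ≤⟨ +-monoˡ-≤ _ (#above-mono s (_<? c) X∈KD) ⟩
    #above s (_<? c) X + #left s c X  ≡⟨ #above-suc s (_<? c) X ⟨
    #above (suc s) (_<? c) X          ≡⟨ #above-≡-of-total (suc s) (_<? c) X∈KD top≡ ⟩
    #above (suc s) (_<? c) D          ≡⟨ #above-suc s (_<? c) D ⟩
    #above s (_<? c) D + #left s c D  ∎)
    where open ≤-Reasoning

  #above-≥-of-#above-≡ : {D X : Diagram} → X ∈KD D →
    #above (suc s) U? X ≡ #above (suc s) U? D → #right s c X ≡ 0 →
    #above s U? D + #right s c D ≤ #above s U? X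
  #above-≥-of-#above-≡ {D} {X} X∈KD top≡ right≡0 = +-cancelʳ-≤ (#left s c X) _ _ (begin
    #above s U? D + #right s c D + #left s c X    ≤⟨ +-monoʳ-≤ _ (#left-≤-of-#above-≡ X∈KD top≡) ⟩
    #above s U? D + #right s c D + #left s c D    ≡⟨ x∙yz≈xz∙y (#above s U? D) (#left s c D) (#right s c D) ⟨
    #above s U? D + (#left s c D + #right s c D)  ≡⟨ cong (#above s U? D +_) (#row-split s c D) ⟨
    #above s U? D + #row s U? D                   ≡⟨ #above-suc s U? D ⟨
    #above (suc s) U? D                           ≡⟨ top≡ ⟨
    #above (suc s) U? X                           ≡⟨ #above-suc s U? X ⟩
    #above s U? X + #row s U? X                   ≡⟨ cong (#above s U? X +_) (#row-split s c X) ⟩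
    #above s U? X + (#left s c X + #right s c X)  ≡⟨ cong (λ n → #above s U? X + (#left s c X + n)) right≡0 ⟩
    #above s U? X + (#left s c X + 0)             ≡⟨ cong (#above s U? X +_) (+-identityʳ _) ⟩
    #above s U? X + #left s c X                   ∎)
    where open ≤-Reasoning

  -- Only moving the rightmost cell of row s, when it lies left of c, shrinks the left part of
  -- row s. Just before such a move, unless the rows above s + 1 already hold extra cells, the
  -- rows above s hold at least #right s c D extra cells, and the move adds one more.
  private
    Persists : Diagram → Diagram → Set
    Persists D X = #above (suc s) U? D < #above (suc s) U? X
                 ⊎ #above s U? D + #right s c D < #above s U? X
                 ⊎ #left s c D ≤ #left s c X

    persists-step : {D X Y : Diagram} → X ∈KD D → KohnertMove X Y → Persists D X → Persists D Y
    persists-step {X = X} {Y} _ mv (inj₁ top<) =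
      inj₁ (<-≤-trans top< (#above-mono {Y = Y} {X} (suc s) U? (mv ◅ ε)))
    persists-step {X = X} {Y} _ mv (inj₂ (inj₁ mid<)) =
      inj₂ (inj₁ (<-≤-trans mid< (#above-mono {Y = Y} {X} s U? (mv ◅ ε))))
    persists-step {D} {X} {Y} X∈KD mv@(i , y , _ , _ , rightmost , _) (inj₂ (inj₂ left≤))
      with (i ≟ s) ×-dec (y <? c)
    ... | no notLeft = inj₂ (inj₂ (≤-trans left≤
          (#cells-mono-move {X = X} {Y = Y} (rect? (_≟ s) (_<? c)) mv λ isLeft → contradiction isLeft notLeft)))
    ... | yes (refl , y<c) with #above (suc s) U? D <? #above (suc s) U? X
    ...   | yes top< = inj₁ (<-≤-trans top< (#above-mono {Y = Y} {X} (suc s) U? (mv ◅ ε)))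
    ...   | no top≮ = inj₂ (inj₁ (begin-strict
            #above s U? D + #right s c D  ≤⟨ #above-≥-of-#above-≡ X∈KD top≡ (rightmost⇒#right≡0 {X} rightmost y<c) ⟩
            #above s U? X                 <⟨ n<1+n _ ⟩
            suc (#above s U? X)           ≡⟨ #above-move-out-of-row {X} {Y} s mv refl ⟨
            #above s U? Y                 ∎))
      where
      open ≤-Reasoning
      top≡ = ≤-antisym (≮⇒≥ top≮) (#above-mono (suc s) U? X∈KD)

  #left-persists : {D T : Diagram} → T ∈KD D →
    #above (suc s) U? T ≤ #above (suc s) U? D → #above s U? T ≤ #above s U? D + #right s c D →
    #left s c D ≤ #left s c T
  #left-persists T∈KD top≤ mid≤
    with foldl (λ D X → X ∈KD D × Persists D X) extend (ε , inj₂ (inj₂ ≤-refl)) T∈KD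
    where
    extend : {D X Y : Diagram} → X ∈KD D × Persists D X → KohnertMove X Y → Y ∈KD D × Persists D Y
    extend {X = X} {Y} (X∈KD , p) mv = X∈KD ◅◅ (mv ◅ ε) , persists-step {X = X} {Y} X∈KD mv p
  ... | _ , inj₁ top<         = contradiction top≤ (<⇒≱ top<)
  ... | _ , inj₂ (inj₁ mid<)  = contradiction mid≤ (<⇒≱ mid<)
  ... | _ , inj₂ (inj₂ left≤) = left≤

module ShiftedWeight where

  open Counting
  open CellCounts
  open Weights
  open LeftOfRow
  open import Data.Nat using (zero; suc; _+_; _≤_; z≤n)
  open import Data.Nat.Properties
  open import Data.Integer as ℤ using (+_)
  open import Data.Empty using (⊥)
  open import Data.List.Membership.Propositional using (_∉_)
  open import Data.Product using (∃; _×_; _,_; proj₁)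
  open import Data.Sum using (inj₁; inj₂)
  open import Relation.Binary.PropositionalEquality
  open import Function using (_∘_)
  open import Relation.Nullary using (¬_; yes; no; contradiction)
  open import Relation.Unary.Properties using (U?)

  module _ {D T : Diagram} {s c r : ℕ} (sc∈D : (s , c) ∈D D) (r<s : r < s)
           (nw : Northwest (InU D (s , c) r)) (rc∈D : (r , c) ∈D D) (T∈KD : T ∈KD D)
           (shift : ∀ i → + wt T i ≡ + wt D i ℤ.+ + Kcount D (s , c) ℤ.* α r s i) where

    open WeightShift {D} {T} {r} {s} {Kcount D (s , c)} r<s shift

    K≡#right : Kcount D (s , c) ≡ #right s c D
    K≡#right = Kcount≡#right D s c

    #left-s-persists : #left s c D ≤ #left s c T
    #left-s-persists = #left-persists s c T∈KD (≤-reflexive #above-past-s)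
      (≤-reflexive (trans (#above-between r<s ≤-refl) (cong (λ n → #above s U? D + n) K≡#right)))

    #right-s-vacated : #right s c T ≡ 0
    #right-s-vacated = n≤0⇒n≡0 (+-cancelˡ-≤ (#left s c T) _ _ (begin
      #left s c T + #right s c T  ≡⟨ wt-split T s c ⟨
      wt T s                      ≡⟨ +-cancelʳ-≡ _ _ (#left s c D) wt-T-s ⟩
      #left s c D                 ≤⟨ #left-s-persists ⟩
      #left s c T                 ≡⟨ +-identityʳ _ ⟨
      #left s c T + 0             ∎))
      where
      open ≤-Reasoning
      wt-T-s : wt T s + #right s c D ≡ #left s c D + #right s c D
      wt-T-s = trans (cong (λ n → wt T s + n) (sym K≡#right)) (trans wt-at-s (wt-split D s c))

    sc∉T : (s , c) ∉ cells T
    sc∉T sc∈T = <-irrefl (sym #right-s-vacated) (∈⇒count-pos (rect? (_≟ s) (c ≤?_)) sc∈T (refl , ≤-refl))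

    #above-s-left-≤ : #above s (_<? c) T ≤ #above s (_<? c) D
    #above-s-left-≤ = +-cancelʳ-≤ (#left s c T) _ _ (begin
      #above s (_<? c) T + #left s c T  ≡⟨ #above-suc s (_<? c) T ⟨
      #above (suc s) (_<? c) T          ≡⟨ #above-≡-of-total (suc s) (_<? c) T∈KD #above-past-s ⟩
      #above (suc s) (_<? c) D          ≡⟨ #above-suc s (_<? c) D ⟩
      #above s (_<? c) D + #left s c D  ≤⟨ +-monoʳ-≤ _ #left-s-persists ⟩
      #above s (_<? c) D + #left s c T  ∎)
      where open ≤-Reasoning

    #above-s-column-c-gain : #above s (_≟ c) D < #above s (_≟ c) T
    #above-s-column-c-gain = begin-strict
      #above s (_≟ c) D                    <⟨ m<m+n _ (∈⇒count-pos (rect? (_≟ s) (_≟ c)) sc∈D (refl , refl)) ⟩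
      #above s (_≟ c) D + #row s (_≟ c) D  ≡⟨ #above-suc s (_≟ c) D ⟨
      #above (suc s) (_≟ c) D              ≡⟨ #above-≡-of-total (suc s) (_≟ c) T∈KD #above-past-s ⟨
      #above (suc s) (_≟ c) T              ≡⟨ #above-suc s (_≟ c) T ⟩
      #above s (_≟ c) T + #row s (_≟ c) T  ≡⟨ cong (λ n → #above s (_≟ c) T + n) sc-column-empty ⟩
      #above s (_≟ c) T + 0                ≡⟨ +-identityʳ _ ⟩
      #above s (_≟ c) T                    ∎
      where
      open ≤-Reasoning
      sc-column-empty : #row s (_≟ c) T ≡ 0
      sc-column-empty = count≡0 (rect? (_≟ s) (_≟ c)) {cells T} λ { x∈T (refl , refl) → sc∉T x∈T }

    new-cell-in-column-c : ∃ λ p → (r ≤ p × p < s) × (p , c) ∈D T × ¬ (p , c) ∈D D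
    new-cell-in-column-c
      with count-<⇒∃∉ _≟ᶜ_ (rect? (between? r s) (_≟ c)) (unique T) band-gain
      where
      band-gain : #band r s (_≟ c) D < #band r s (_≟ c) T
      band-gain = +-cancelˡ-< (#above r (_≟ c) D) _ _ (begin-strict
        #above r (_≟ c) D + #band r s (_≟ c) D  ≡⟨ #above-band (<⇒≤ r<s) (_≟ c) D ⟨
        #above s (_≟ c) D                       <⟨ #above-s-column-c-gain ⟩
        #above s (_≟ c) T                       ≡⟨ #above-band (<⇒≤ r<s) (_≟ c) T ⟩
        #above r (_≟ c) T + #band r s (_≟ c) T  ≡⟨ cong (_+ #band r s (_≟ c) T) above-r-column-c ⟩
        #above r (_≟ c) D + #band r s (_≟ c) T  ∎)
        where
        open ≤-Reasoning
        above-r-column-c : #above r (_≟ c) T ≡ #above r (_≟ c) D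
        above-r-column-c = #above-≡-of-total r (_≟ c) T∈KD (#above-upto-r ≤-refl)
    ... | (p , _) , pc∈T , (bounds , refl) , pc∉D = p , bounds , pc∈T , pc∉D

    gap⇒#right≡0 : {q : ℕ} → r ≤ q → q < s → ¬ (q , c) ∈D D → #right q c D ≡ 0
    gap⇒#right≡0 {q} r≤q q<s qc∉D = count≡0 (rect? (_≟ q) (c ≤?_)) {cells D}
      λ { {_ , b} qb∈D (refl , c≤b) → qc∉D (case-on-column qb∈D c≤b) }
      where
      case-on-column : {b : ℕ} → (q , b) ∈D D → c ≤ b → (q , c) ∈D D
      case-on-column {b} qb∈D c≤b with b ≟ c
      ... | yes refl = qb∈D
      ... | no b≢c = proj₁ (nw q s c b (sc∈D , inj₂ (refl , ≤-refl)) (qb∈D , inj₁ (r≤q , q<s))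
                              q<s (≤∧≢⇒< c≤b (b≢c ∘ sym)))

    gap⇒wt-T≡#left : {q : ℕ} → r ≤ q → q < s → ¬ (q , c) ∈D D → wt T q ≡ #left q c D
    gap⇒wt-T≡#left {q} r≤q q<s qc∉D = begin
      wt T q                      ≡⟨ wt-elsewhere q≢r (<⇒≢ q<s) ⟩
      wt D q                      ≡⟨ wt-split D q c ⟩
      #left q c D + #right q c D  ≡⟨ cong (λ n → #left q c D + n) (gap⇒#right≡0 r≤q q<s qc∉D) ⟩
      #left q c D + 0             ≡⟨ +-identityʳ _ ⟩
      #left q c D                 ∎
      where
      open ≡-Reasoning
      q≢r : q ≢ r
      q≢r refl = qc∉D rc∈D

    D-cell-below-new-left-cell : {m j : ℕ} → m < s → (m , j) ∈D T → ¬ (m , j) ∈D D → j < c →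
      ∃ λ a → (m < a × a < s) × (a , j) ∈D D
    D-cell-below-new-left-cell {m} {j} m<s mj∈T mj∉D j<c
      with count-pos⇒∈ (rect? (between? (suc m) s) (_≟ j)) (cells D) band-nonempty
      where
      open ≤-Reasoning
      mj-absent : #row m (_≟ j) D ≡ 0
      mj-absent = count≡0 (rect? (_≟ m) (_≟ j)) {cells D} λ { x∈D (refl , refl) → mj∉D x∈D }
      column-j-gain : #above (suc m) (_≟ j) D < #above (suc m) (_≟ j) T
      column-j-gain = begin-strict
        #above (suc m) (_≟ j) D              ≡⟨ #above-suc m (_≟ j) D ⟩
        #above m (_≟ j) D + #row m (_≟ j) D  ≡⟨ cong (λ n → #above m (_≟ j) D + n) mj-absent ⟩
        #above m (_≟ j) D + 0                ≡⟨ +-identityʳ _ ⟩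
        #above m (_≟ j) D                    ≤⟨ #above-mono m (_≟ j) T∈KD ⟩
        #above m (_≟ j) T                    <⟨ m<m+n _ (∈⇒count-pos (rect? (_≟ m) (_≟ j)) mj∈T (refl , refl)) ⟩
        #above m (_≟ j) T + #row m (_≟ j) T  ≡⟨ #above-suc m (_≟ j) T ⟨
        #above (suc m) (_≟ j) T              ∎
      column-j-no-gain : #above s (_≟ j) T ≤ #above s (_≟ j) D
      column-j-no-gain = #above-restrict-≤ s (_<? c) (_≟ j) (λ { refl → j<c }) T∈KD #above-s-left-≤
      band-nonempty : 0 < #band (suc m) s (_≟ j) D
      band-nonempty = +-cancelˡ-< (#above (suc m) (_≟ j) D) _ _ (begin-strict
        #above (suc m) (_≟ j) D + 0                         ≡⟨ +-identityʳ _ ⟩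
        #above (suc m) (_≟ j) D                             <⟨ column-j-gain ⟩
        #above (suc m) (_≟ j) T                             ≤⟨ m≤m+n _ _ ⟩
        #above (suc m) (_≟ j) T + #band (suc m) s (_≟ j) T  ≡⟨ #above-band m<s (_≟ j) T ⟨
        #above s (_≟ j) T                                   ≤⟨ column-j-no-gain ⟩
        #above s (_≟ j) D                                   ≡⟨ #above-band m<s (_≟ j) D ⟩
        #above (suc m) (_≟ j) D + #band (suc m) s (_≟ j) D  ∎)
    ... | (a , _) , aj∈D , ((m<a , a<s) , refl) = a , (m<a , a<s) , aj∈D

    left-gain⇒gap : {m : ℕ} → r ≤ m → m < s → #left m c D < #left m c T → ¬ (m , c) ∈D D
    left-gain⇒gap {m} r≤m m<s gain mc∈D
      with count-<⇒∃∉ _≟ᶜ_ (rect? (_≟ m) (_<? c)) (unique T) gain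
    ... | (_ , j) , mj∈T , (refl , j<c) , mj∉D
      with D-cell-below-new-left-cell m<s mj∈T mj∉D j<c
    ... | a , (m<a , a<s) , aj∈D =
      mj∉D (proj₁ (nw m a j c (aj∈D , inj₁ (≤-trans r≤m (<⇒≤ m<a) , a<s)) (mc∈D , inj₁ (r≤m , m<s))
                      m<a j<c))

    #left-≤ : {m : ℕ} → r ≤ m → m < s → #left m c T ≤ #left m c D
    #left-≤ {m} r≤m m<s with #left m c T ≤? #left m c D
    ... | yes T≤D = T≤D
    ... | no T≰D = begin
      #left m c T                 ≤⟨ m≤m+n _ _ ⟩
      #left m c T + #right m c T  ≡⟨ wt-split T m c ⟨
      wt T m                      ≡⟨ gap⇒wt-T≡#left r≤m m<s (left-gain⇒gap r≤m m<s (≰⇒> T≰D)) ⟩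
      #left m c D                 ∎
      where open ≤-Reasoning

    #above-left-≤ : {m : ℕ} → m ≤ s → #above m (_<? c) T ≤ #above m (_<? c) D
    #above-left-≤ {m} m≤s with m ≤? r
    ... | yes m≤r = ≤-reflexive (#above-≡-of-total m (_<? c) T∈KD (#above-upto-r m≤r))
    #above-left-≤ {zero} _ | no 0≰r = contradiction z≤n 0≰r
    #above-left-≤ {suc m} m<s | no m≰r = begin
      #above (suc m) (_<? c) T          ≡⟨ #above-suc m (_<? c) T ⟩
      #above m (_<? c) T + #left m c T  ≤⟨ +-mono-≤ (#above-left-≤ (<⇒≤ m<s)) (#left-≤ (≤-pred (≰⇒> m≰r)) m<s) ⟩
      #above m (_<? c) D + #left m c D  ≡⟨ #above-suc m (_<? c) D ⟨
      #above (suc m) (_<? c) D          ∎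
      where open ≤-Reasoning

    no-weight-shift : ⊥
    no-weight-shift with new-cell-in-column-c
    ... | p , (r≤p , p<s) , pc∈T , pc∉D = <-irrefl refl (begin-strict
      #above (suc p) (_<? c) T          ≡⟨ #above-suc p (_<? c) T ⟩
      #above p (_<? c) T + #left p c T  <⟨ +-mono-≤-< (#above-left-≤ (<⇒≤ p<s)) row-p-loses ⟩
      #above p (_<? c) D + #left p c D  ≡⟨ #above-suc p (_<? c) D ⟨
      #above (suc p) (_<? c) D          ≤⟨ #above-mono (suc p) (_<? c) T∈KD ⟩
      #above (suc p) (_<? c) T          ∎)
      where
      open ≤-Reasoning
      row-p-loses : #left p c T < #left p c D
      row-p-loses = begin-strict
        #left p c T                 <⟨ m<m+n _ (∈⇒count-pos (rect? (_≟ p) (c ≤?_)) pc∈T (refl , ≤-refl)) ⟩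
        #left p c T + #right p c T  ≡⟨ wt-split T p c ⟨
        wt T p                      ≡⟨ gap⇒wt-T≡#left r≤p p<s pc∉D ⟩
        #left p c D                 ∎

open import Data.Integer using (_+_; _*_; +_)
open import Data.Product using (Σ; _×_; _,_)
open import Relation.Binary.PropositionalEquality using (_≡_)
open import Relation.Nullary using (¬_)

lemma4p14 : (D : Diagram) (s c r : ℕ) → (s , c) ∈D D → r < s →
    Northwest (InU D (s , c) r) → (r , c) ∈D D →
    ¬ (Σ Diagram λ T → (T ∈KD D) ×
    (∀ i → + wt T i ≡ + wt D i + + Kcount D (s , c) * α r s i))
lemma4p14 D s c r sc∈D r<s nw rc∈D (T , T∈KD , shift) =
  ShiftedWeight.no-weight-shift sc∈D r<s nw rc∈D T∈KD shift
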